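{- Let $S=S(s,t,u,v;z)$, $B=B(s,t,u,v;z)$, $R=R(s,t,u,v;z)$ be the generating functions defined in the context. Then $$S=uvz\,(1+S|_{v=1})(1+sB),\qquad B=vz\,(t+tR|_{v=1}+B|_{v=1})(1+sB),\qquad R=uvz\,(1+R|_{v=1}+B|_{v=1})(1+sB),$$ where $F|_{v=1}$ denotes $F(s,t,u,1;z)$.
   Context: A Dyck path of length $n$ is a lattice path from $(0,0)$ to $(n,n)$ with east steps $(1,0)$ and north steps $(0,1)$ never going above $y=x$; it is encoded by $d_1\cdots d_n$, where $d_i$ (the height of the $i$-th east step) is the number of north steps before it. A two-colored Dyck path is one whose east steps are each colored black or red. Conditions: (c-1) every east step of height $0$ is red; (c-2) the first east step of each positive height is black. $\mathcal{A}_n$ is the set of two-colored Dyck paths of length $n$ satisfying (c-1) and (c-2); $\mathcal{B}_n$ (resp. $\mathcal{R}_n$) is the set of two-colored Dyck paths of length $n$ satisfying (c-2) whose first east step is black (resp. red). Statistics of $D=d_1\cdots d_n$: $\mathrm{turn}(D)$ = (number of east steps immediately followed by a north step) $-1$; $\mathrm{segment}(D)$ = number of maximal strings of consecutive black east steps all of the same height; $\mathrm{red}(D)$ = number of red east steps; $\mathrm{return}(D)=|\{i\in[n]:d_i=i-1\}|$ (the number of times $D$ touches the diagonal after the first east step). For $\mathcal{X}\in\{\mathcal{A},\mathcal{B},\mathcal{R}\}$ put $X_n(s,t,u,v)=\sum_{D\in\mathcal{X}_n}s^{\mathrm{turn}(D)}t^{\mathrm{segment}(D)}u^{\mathrm{red}(D)}v^{\mathrm{return}(D)}$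 and define formal power series $S=\sum_{n\ge1}A_n(s,t,u,v)z^n$ (with $X=A$ written $S_n$), $B=\sum_{n\geq1}B_n(s,t,u,v)z^n$, $R=\sum_{n\ge1}R_n(s,t,u,v)z^n$. -}

module Defs where

open import Data.Nat as ℕ using (ℕ; zero; suc; _∸_; _≤ᵇ_; _≡ᵇ_; _<ᵇ_)
open import Data.Bool using (Bool; true; false; _∧_; _∨_; not; if_then_else_)
open import Data.List using (List; []; _∷_; map; concatMap; upTo; length; foldr; filterᵇ)
open import Data.Product using (_×_; _,_)
open import Data.Maybe using (Maybe; just; nothing)
open import Algebra.Bundles using (CommutativeSemiring)

-- Two-colored Dyck paths, encoded by the list of their east steps
-- (d_i , colour_i), i = 1..n.  A Dyck path of length n is a list of
-- length n with d_1 ≤ d_2 ≤ ... ≤ d_n and d_i ≤ i - 1.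

data Colour : Set where
  black red : Colour

isBlack : Colour → Bool
isBlack black = true
isBlack red   = false

isRed : Colour → Bool
isRed c = not (isBlack c)

Step : Set
Step = ℕ × Colour

CPath : Set
CPath = List Step

stepsBelow : ℕ → List Step
stepsBelow m = concatMap (λ h → (h , black) ∷ (h , red) ∷ []) (upTo m)

candidates : ℕ → ℕ → List CPath
candidates zero    m = [] ∷ []
candidates (suc k) m = concatMap (λ p → map (_∷ p) (stepsBelow m)) (candidates k m)

-- Dyck condition: position i (1-based), previous height prev
dyckAux : ℕ → ℕ → CPath → Bool
dyckAux i prev []            = true
dyckAux i prev ((h , _) ∷ p) = (prev ≤ᵇ h) ∧ ((h <ᵇ i) ∧ dyckAux (suc i) h p)

isDyck : CPath → Bool
isDyck = dyckAux 1 0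

c1 : CPath → Bool
c1 []            = true
c1 ((h , c) ∷ p) = (if h ≡ᵇ 0 then isRed c else true) ∧ c1 p

-- is h a height not occurring before (given the previous height, paths weakly increasing)
newHeight : Maybe ℕ → ℕ → Bool
newHeight nothing   h = true
newHeight (just h') h = not (h' ≡ᵇ h)

c2Aux : Maybe ℕ → CPath → Bool
c2Aux mp []            = true
c2Aux mp ((h , c) ∷ p) =
  (if (0 <ᵇ h) ∧ newHeight mp h then isBlack c else true) ∧ c2Aux (just h) p

c2 : CPath → Bool
c2 = c2Aux nothing

firstIs : Colour → CPath → Bool
firstIs black []            = false
firstIs red   []            = false
firstIs black ((_ , c) ∷ _) = isBlack c
firstIs red   ((_ , c) ∷ _) = isRed c

-- the sets 𝒜_n, ℬ_n, ℛ_n (as duplicate-free lists)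
𝒜 : ℕ → List CPath
𝒜 n = filterᵇ (λ p → isDyck p ∧ (c1 p ∧ c2 p)) (candidates n n)

ℬ : ℕ → List CPath
ℬ n = filterᵇ (λ p → isDyck p ∧ (c2 p ∧ firstIs black p)) (candidates n n)

ℛ : ℕ → List CPath
ℛ n = filterᵇ (λ p → isDyck p ∧ (c2 p ∧ firstIs red p)) (candidates n n)

b2n : Bool → ℕ
b2n true  = 1
b2n false = 0

-- number of east steps immediately followed by a north step, for a path
-- of length n: step i < n is followed by north iff d_{i+1} > d_i;
-- the last step is followed by north iff d_n < n.
turnCount : ℕ → CPath → ℕ
turnCount n []                              = 0
turnCount n ((h , _) ∷ [])                  = b2n (h <ᵇ n)
turnCount n ((h , _) ∷ ((h' , c') ∷ p))     = b2n (h <ᵇ h') ℕ.+ turnCount n ((h' , c') ∷ p)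

turn : CPath → ℕ
turn p = turnCount (length p) p ∸ 1

-- a black step starts a new maximal black same-height string
startsSeg : Maybe Step → Step → Bool
startsSeg nothing           (h , c) = isBlack c
startsSeg (just (h' , c'))  (h , c) = isBlack c ∧ (not (isBlack c') ∨ not (h' ≡ᵇ h))

segAux : Maybe Step → CPath → ℕ
segAux m []       = 0
segAux m (x ∷ p)  = b2n (startsSeg m x) ℕ.+ segAux (just x) p

segment : CPath → ℕ
segment = segAux nothing

red# : CPath → ℕ
red# []            = 0
red# ((_ , c) ∷ p) = b2n (isRed c) ℕ.+ red# p

-- |{ i : d_i = i - 1 }|, with j = i - 1 the 0-based index
retAux : ℕ → CPath → ℕ
retAux j []            = 0
retAux j ((h , _) ∷ p) = b2n (h ≡ᵇ j) ℕ.+ retAux (suc j) p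

return# : CPath → ℕ
return# = retAux 0

-- Generating functions with coefficients in an arbitrary commutative
-- semiring (taking the polynomial semiring ℕ[s,t,u,v] recovers the paper).

module GF {c ℓ} (K : CommutativeSemiring c ℓ) where
  open CommutativeSemiring K public

  pow : Carrier → ℕ → Carrier
  pow x zero    = 1#
  pow x (suc n) = x * pow x n

  Σ : List Carrier → Carrier
  Σ = foldr _+_ 0#

  weight : Carrier → Carrier → Carrier → Carrier → CPath → Carrier
  weight s t u v D =
    pow s (turn D) * (pow t (segment D) * (pow u (red# D) * pow v (return# D)))

  genPoly : (ℕ → List CPath) → ℕ → Carrier → Carrier → Carrier → Carrier → Carrier
  genPoly 𝒳 n s t u v = Σ (map (weight s t u v) (𝒳 n))

  -- formal power series in z: coefficient sequences
  Series : Set c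
  Series = ℕ → Carrier

  gf : (ℕ → List CPath) → Carrier → Carrier → Carrier → Carrier → Series
  gf 𝒳 s t u v zero    = 0#
  gf 𝒳 s t u v (suc n) = genPoly 𝒳 (suc n) s t u v

  S B R : Carrier → Carrier → Carrier → Carrier → Series
  S = gf 𝒜
  B = gf ℬ
  R = gf ℛ

  one : Series
  one zero    = 1#
  one (suc _) = 0#

  infixl 6 _⊕_
  infixl 7 _⊛_ _·_
  _⊕_ : Series → Series → Series
  (f ⊕ g) n = f n + g n

  _·_ : Carrier → Series → Series
  (a · f) n = a * f n

  _⊛_ : Series → Series → Series
  (f ⊛ g) n = Σ (map (λ i → f i * g (n ∸ i)) (upTo (suc n)))

  zS : Series → Series
  zS f zero    = 0#
  zS f (suc n) = f n

  infix 4 _≋_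
  _≋_ : Series → Series → Set ℓ
  f ≋ g = ∀ n → f n ≈ g n

module Submission where

-- Every weight is a product of local factors, one per east step, depending only on the step, its
-- predecessor and its position; so each generating function is a sum of products over
-- step-by-step extensions. A path starts with an east step of height 0, of weight u v if red and
-- t v if black. Cut the rest at the first later return to the diagonal. The steps before it stay
-- strictly below the diagonal: moved back by one position they form an arbitrary path of the same
-- kind whose returns no longer carry v, giving 1 + S|_{v=1} (for ℬ and ℛ, splitting on the colour
-- of the next step of height 0, t + t R|_{v=1} + B|_{v=1} and 1 + R|_{v=1} + B|_{v=1}). The
-- returning step follows a north step and opens a new height, so it is black and weighs s t v;
-- translated to the origin it starts a ℬ-path, and the part from it onwards contributes 1 + s B.

open import Defs
open import Algebra.Bundles using (CommutativeSemiring)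
open import Data.Bool using (Bool; true; false; _∧_; not; if_then_else_)
open import Data.Bool.Properties using (∧-commutativeMonoid; ∧-zeroʳ; ∨-zeroʳ)
open import Data.List using (List; []; _∷_; map; concatMap; upTo; applyUpTo; length; filterᵇ; _++_)
open import Data.List.Properties using (map-++; map-∘)
open import Data.Maybe using (Maybe; just; nothing)
open import Data.Nat as ℕ using (ℕ; zero; suc; _∸_; _≤_; _≤ᵇ_; _≡ᵇ_; _<ᵇ_; s≤s; z≤n)
import Data.Nat.Properties as ℕₚ
open ℕₚ using (+-suc; ≤-refl; ≤-trans; ≤-reflexive; ≤-total; ≤-pred; m≤m+n; m≤n⇒m≤1+n;
         m≤n⇒∃[o]m+o≡n; m+[n∸m]≡n)
open import Data.Product using (_×_; _,_; proj₁; proj₂)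
open import Data.Sum using (inj₁; inj₂)
open import Function using (_∘_; id)
open import Relation.Binary.PropositionalEquality as ≡ using (_≡_)
import Algebra.Solver.CommutativeMonoid as CommutativeMonoidSolver

<ᵇ-suc : ∀ m n → (m <ᵇ suc n) ≡ (m ≤ᵇ n)
<ᵇ-suc zero    n = ≡.refl
<ᵇ-suc (suc m) n = ≡.refl

+-cancelˡ-<ᵇ : ∀ a m n → (a ℕ.+ m <ᵇ a ℕ.+ n) ≡ (m <ᵇ n)
+-cancelˡ-<ᵇ zero    m n = ≡.refl
+-cancelˡ-<ᵇ (suc a) m n = +-cancelˡ-<ᵇ a m n

+-cancelˡ-≡ᵇ : ∀ a m n → (a ℕ.+ m ≡ᵇ a ℕ.+ n) ≡ (m ≡ᵇ n)
+-cancelˡ-≡ᵇ zero    m n = ≡.refl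
+-cancelˡ-≡ᵇ (suc a) m n = +-cancelˡ-≡ᵇ a m n

+-cancelˡ-≤ᵇ : ∀ a m n → (a ℕ.+ m ≤ᵇ a ℕ.+ n) ≡ (m ≤ᵇ n)
+-cancelˡ-≤ᵇ a m n = begin
  a ℕ.+ m ≤ᵇ a ℕ.+ n        ≡⟨ <ᵇ-suc (a ℕ.+ m) (a ℕ.+ n) ⟨
  a ℕ.+ m <ᵇ suc (a ℕ.+ n)  ≡⟨ ≡.cong (a ℕ.+ m <ᵇ_) (+-suc a n) ⟨
  a ℕ.+ m <ᵇ a ℕ.+ suc n    ≡⟨ +-cancelˡ-<ᵇ a m (suc n) ⟩
  m <ᵇ suc n                ≡⟨ <ᵇ-suc m n ⟩
  m ≤ᵇ n                    ∎
  where open ≡.≡-Reasoning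

≡ᵇ-refl : ∀ n → (n ≡ᵇ n) ≡ true
≡ᵇ-refl zero    = ≡.refl
≡ᵇ-refl (suc n) = ≡ᵇ-refl n

n<ᵇ1+n : ∀ n → (n <ᵇ suc n) ≡ true
n<ᵇ1+n zero    = ≡.refl
n<ᵇ1+n (suc n) = n<ᵇ1+n n

<ᵇ⇒≤ᵇ : ∀ m n → (m <ᵇ n) ≡ true → (m ≤ᵇ n) ≡ true
<ᵇ⇒≤ᵇ zero    n       _ = ≡.refl
<ᵇ⇒≤ᵇ (suc m) (suc n) e = ≡.trans (<ᵇ-suc m n) (<ᵇ⇒≤ᵇ m n e)

<ᵇ⇒≢ᵇ : ∀ m n → (m <ᵇ n) ≡ true → (m ≡ᵇ n) ≡ false
<ᵇ⇒≢ᵇ zero    (suc n) _ = ≡.refl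
<ᵇ⇒≢ᵇ (suc m) (suc n) e = <ᵇ⇒≢ᵇ m n e

<ᵇ-≤-trans : ∀ m n o → (m <ᵇ n) ≡ true → n ≤ o → (m <ᵇ o) ≡ true
<ᵇ-≤-trans zero    (suc n) (suc o) _ _         = ≡.refl
<ᵇ-≤-trans (suc m) (suc n) (suc o) e (s≤s n≤o) = <ᵇ-≤-trans m n o e n≤o

m<ᵇn⇒m<ᵇ1+n : ∀ m n → (m <ᵇ n) ≡ true → (m <ᵇ suc n) ≡ true
m<ᵇn⇒m<ᵇ1+n m n e = <ᵇ-≤-trans m n (suc n) e (m≤n⇒m≤1+n ≤-refl)

≤⇒≮ᵇ : ∀ m n → n ≤ m → (m <ᵇ n) ≡ false
≤⇒≮ᵇ m       zero    _         = ≡.refl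
≤⇒≮ᵇ (suc m) (suc n) (s≤s n≤m) = ≤⇒≮ᵇ m n n≤m

≮ᵇ-≢ᵇ⇒≮ᵇsuc : ∀ m n → (m <ᵇ n) ≡ false → (m ≡ᵇ n) ≡ false → (m <ᵇ suc n) ≡ false
≮ᵇ-≢ᵇ⇒≮ᵇsuc zero    zero    _ ()
≮ᵇ-≢ᵇ⇒≮ᵇsuc zero    (suc n) () _
≮ᵇ-≢ᵇ⇒≮ᵇsuc (suc m) zero    _ _ = ≡.refl
≮ᵇ-≢ᵇ⇒≮ᵇsuc (suc m) (suc n) e f = ≮ᵇ-≢ᵇ⇒≮ᵇsuc m n e f

∧-true : ∀ {a b} → a ∧ b ≡ true → (a ≡ true) × (b ≡ true)
∧-true {true} {true} _ = ≡.refl , ≡.refl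

module _ where
  open CommutativeMonoidSolver ∧-commutativeMonoid using (solve; _⊜_; _⊕_) renaming (id to ⊤)

  ∧-interleave : ∀ a b e f D C₁ C₂ →
    (a ∧ (b ∧ D)) ∧ ((e ∧ C₁) ∧ (f ∧ C₂))
      ≡ (a ∧ (b ∧ (e ∧ (f ∧ true)))) ∧ (D ∧ (C₁ ∧ C₂))
  ∧-interleave = solve 7 (λ a b e f D C₁ C₂ →
    (a ⊕ (b ⊕ D)) ⊕ ((e ⊕ C₁) ⊕ (f ⊕ C₂)) ⊜ (a ⊕ (b ⊕ (e ⊕ (f ⊕ ⊤)))) ⊕ (D ⊕ (C₁ ⊕ C₂)))
    ≡.refl

  ∧-interleave′ : ∀ a b f g D C →
    (a ∧ (b ∧ D)) ∧ ((f ∧ C) ∧ g) ≡ (a ∧ (b ∧ (f ∧ g))) ∧ (D ∧ C)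
  ∧-interleave′ = solve 6 (λ a b f g D C →
    (a ⊕ (b ⊕ D)) ⊕ ((f ⊕ C) ⊕ g) ⊜ (a ⊕ (b ⊕ (f ⊕ g))) ⊕ (D ⊕ C)) ≡.refl

module FiniteSums {c ℓ} (K : CommutativeSemiring c ℓ) where
  open GF K
  open import Algebra.Properties.CommutativeSemigroup +-commutativeSemigroup
    using () renaming (interchange to +-interchange)
  open import Relation.Binary.Reasoning.Setoid setoid

  sumBelow : (ℕ → Carrier) → ℕ → Carrier
  sumBelow f zero    = 0#
  sumBelow f (suc M) = f 0 + sumBelow (f ∘ suc) M

  sumBelow-cong : ∀ {f g} M → (∀ h → suc h ≤ M → f h ≈ g h) → sumBelow f M ≈ sumBelow g M
  sumBelow-cong zero    _ = refl
  sumBelow-cong (suc M) e = +-cong (e 0 (s≤s z≤n)) (sumBelow-cong M (λ h h<M → e (suc h) (s≤s h<M)))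

  sumBelow-zero : ∀ {f} M → (∀ h → suc h ≤ M → f h ≈ 0#) → sumBelow f M ≈ 0#
  sumBelow-zero zero    _ = refl
  sumBelow-zero (suc M) e =
    trans (+-cong (e 0 (s≤s z≤n)) (sumBelow-zero M (λ h h<M → e (suc h) (s≤s h<M)))) (+-identityˡ 0#)

  sumBelow-+ : ∀ f g M → sumBelow (λ h → f h + g h) M ≈ sumBelow f M + sumBelow g M
  sumBelow-+ f g zero    = sym (+-identityˡ 0#)
  sumBelow-+ f g (suc M) = trans (+-congˡ (sumBelow-+ (f ∘ suc) (g ∘ suc) M)) (+-interchange _ _ _ _)

  *-distribˡ-sumBelow : ∀ a f M → a * sumBelow f M ≈ sumBelow (λ h → a * f h) M
  *-distribˡ-sumBelow a f zero    = zeroʳ a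
  *-distribˡ-sumBelow a f (suc M) = trans (distribˡ a _ _) (+-congˡ (*-distribˡ-sumBelow a (f ∘ suc) M))

  *-distribʳ-sumBelow : ∀ a f M → sumBelow f M * a ≈ sumBelow (λ h → f h * a) M
  *-distribʳ-sumBelow a f M = begin
    sumBelow f M * a                ≈⟨ *-comm _ a ⟩
    a * sumBelow f M                ≈⟨ *-distribˡ-sumBelow a f M ⟩
    sumBelow (λ h → a * f h) M      ≈⟨ sumBelow-cong M (λ h _ → *-comm a (f h)) ⟩
    sumBelow (λ h → f h * a) M      ∎

  sumBelow-split : ∀ f a M → sumBelow f (a ℕ.+ M) ≈ sumBelow f a + sumBelow (λ h → f (a ℕ.+ h)) M
  sumBelow-split f zero    M = sym (+-identityˡ _)
  sumBelow-split f (suc a) M = trans (+-congˡ (sumBelow-split (f ∘ suc) a M)) (sym (+-assoc _ _ _))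

  sumBelow-swap : ∀ (f : ℕ → ℕ → Carrier) N M →
    sumBelow (λ a → sumBelow (f a) M) N ≈ sumBelow (λ h → sumBelow (λ a → f a h) N) M
  sumBelow-swap f zero    M = sym (sumBelow-zero M (λ _ _ → refl))
  sumBelow-swap f (suc N) M = begin
    sumBelow (f 0) M + sumBelow (λ a → sumBelow (f (suc a)) M) N
      ≈⟨ +-congˡ (sumBelow-swap (f ∘ suc) N M) ⟩
    sumBelow (f 0) M + sumBelow (λ h → sumBelow (λ a → f (suc a) h) N) M
      ≈⟨ sumBelow-+ (f 0) _ M ⟨
    sumBelow (λ h → sumBelow (λ a → f a h) (suc N)) M
      ∎

  sumBelow-single : ∀ f j M → suc j ≤ M → (∀ h → (h ≡ᵇ j) ≡ false → f h ≈ 0#) →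
    sumBelow f M ≈ f j
  sumBelow-single f zero    (suc M) _ e =
    trans (+-congˡ (sumBelow-zero M (λ h _ → e (suc h) ≡.refl))) (+-identityʳ _)
  sumBelow-single f (suc j) (suc M) (s≤s j<M) e =
    trans (+-cong (e 0 ≡.refl) (sumBelow-single (f ∘ suc) j M j<M (e ∘ suc))) (+-identityˡ _)

  Σ-++ : ∀ xs ys → Σ (xs ++ ys) ≈ Σ xs + Σ ys
  Σ-++ []       ys = sym (+-identityˡ _)
  Σ-++ (x ∷ xs) ys = trans (+-congˡ (Σ-++ xs ys)) (sym (+-assoc _ _ _))

  Σ-map-cong : ∀ {A : Set} {f g : A → Carrier} L → (∀ a → f a ≈ g a) → Σ (map f L) ≈ Σ (map g L)
  Σ-map-cong []      _ = refl
  Σ-map-cong (x ∷ L) e = +-cong (e x) (Σ-map-cong L e)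

  Σ-map-+ : ∀ {A : Set} (f g : A → Carrier) L → Σ (map (λ a → f a + g a) L) ≈ Σ (map f L) + Σ (map g L)
  Σ-map-+ f g []      = sym (+-identityˡ 0#)
  Σ-map-+ f g (x ∷ L) = trans (+-congˡ (Σ-map-+ f g L)) (+-interchange _ _ _ _)

  *-distribˡ-Σ-map : ∀ {A : Set} a (f : A → Carrier) L → a * Σ (map f L) ≈ Σ (map (λ x → a * f x) L)
  *-distribˡ-Σ-map a f []      = zeroʳ a
  *-distribˡ-Σ-map a f (x ∷ L) = trans (distribˡ a _ _) (+-congˡ (*-distribˡ-Σ-map a f L))

  Σ-map-concatMap : ∀ {A B : Set} (f : B → Carrier) (g : A → List B) L →
    Σ (map f (concatMap g L)) ≈ Σ (map (λ a → Σ (map f (g a))) L)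
  Σ-map-concatMap f g []      = refl
  Σ-map-concatMap f g (x ∷ L) rewrite map-++ f (g x) (concatMap g L) =
    trans (Σ-++ (map f (g x)) _) (+-congˡ (Σ-map-concatMap f g L))

  Σ-map-sumBelow : ∀ {A : Set} (f : A → ℕ → Carrier) L M →
    Σ (map (λ a → sumBelow (f a) M) L) ≈ sumBelow (λ h → Σ (map (λ a → f a h) L)) M
  Σ-map-sumBelow f []      M = sym (sumBelow-zero M (λ _ _ → refl))
  Σ-map-sumBelow f (x ∷ L) M = trans (+-congˡ (Σ-map-sumBelow f L M)) (sym (sumBelow-+ (f x) _ M))

  Σ-map-applyUpTo : ∀ (f : ℕ → Carrier) g M → Σ (map f (applyUpTo g M)) ≈ sumBelow (f ∘ g) M
  Σ-map-applyUpTo f g zero    = refl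
  Σ-map-applyUpTo f g (suc M) = +-congˡ (Σ-map-applyUpTo f (g ∘ suc) M)

  Σ-map-upTo : ∀ (f : ℕ → Carrier) M → Σ (map f (upTo M)) ≈ sumBelow f M
  Σ-map-upTo f = Σ-map-applyUpTo f id

  Σ-map-filterᵇ : ∀ {A : Set} (f : A → Carrier) (Q : A → Bool) L →
    Σ (map f (filterᵇ Q L)) ≈ Σ (map (λ x → if Q x then f x else 0#) L)
  Σ-map-filterᵇ f Q []      = refl
  Σ-map-filterᵇ f Q (x ∷ L) with Q x
  ... | true  = +-congˡ (Σ-map-filterᵇ f Q L)
  ... | false = trans (Σ-map-filterᵇ f Q L) (sym (+-identityˡ _))

  sumSteps : ℕ → (Step → Carrier) → Carrier
  sumSteps M f = sumBelow (λ h → f (h , black) + f (h , red)) M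

  sumSteps-cong : ∀ M {f g} → (∀ h c → f (h , c) ≈ g (h , c)) → sumSteps M f ≈ sumSteps M g
  sumSteps-cong M e = sumBelow-cong M (λ h _ → +-cong (e h black) (e h red))

  sumSteps-+ : ∀ M f g → sumSteps M (λ x → f x + g x) ≈ sumSteps M f + sumSteps M g
  sumSteps-+ M f g = trans (sumBelow-cong M (λ h _ → +-interchange _ _ _ _)) (sumBelow-+ _ _ M)

  sumSteps-single : ∀ f j M → suc j ≤ M → (∀ h c → (h ≡ᵇ j) ≡ false → f (h , c) ≈ 0#) →
    sumSteps M f ≈ f (j , black) + f (j , red)
  sumSteps-single f j M j<M e =
    sumBelow-single _ j M j<M (λ h h≢j → trans (+-cong (e h black h≢j) (e h red h≢j)) (+-identityˡ 0#))

  Σ-map-stepsBelow : ∀ (f : Step → Carrier) M → Σ (map f (stepsBelow M)) ≈ sumSteps M f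
  Σ-map-stepsBelow f M = begin
    Σ (map f (stepsBelow M))
      ≈⟨ Σ-map-concatMap f _ (upTo M) ⟩
    Σ (map (λ h → f (h , black) + (f (h , red) + 0#)) (upTo M))
      ≈⟨ Σ-map-upTo _ M ⟩
    sumBelow (λ h → f (h , black) + (f (h , red) + 0#)) M
      ≈⟨ sumBelow-cong M (λ h _ → +-congˡ (+-identityʳ _)) ⟩
    sumSteps M f
      ∎

  Σ-map-∷-stepsBelow : ∀ (f : CPath → Carrier) p M →
    Σ (map f (map (_∷ p) (stepsBelow M))) ≈ sumSteps M (λ x → f (x ∷ p))
  Σ-map-∷-stepsBelow f p M rewrite ≡.sym (map-∘ {g = f} {f = _∷ p} (stepsBelow M)) =
    Σ-map-stepsBelow (λ x → f (x ∷ p)) M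

  Σ-candidates-cong∷ : ∀ {f g : CPath → Carrier} n M →
    (∀ h c p → f ((h , c) ∷ p) ≈ g ((h , c) ∷ p)) →
    Σ (map f (candidates (suc n) M)) ≈ Σ (map g (candidates (suc n) M))
  Σ-candidates-cong∷ {f} {g} n M e = begin
    Σ (map f (candidates (suc n) M))
      ≈⟨ Σ-map-concatMap f _ (candidates n M) ⟩
    Σ (map (λ p → Σ (map f (map (_∷ p) (stepsBelow M)))) (candidates n M))
      ≈⟨ Σ-map-cong (candidates n M) extend ⟩
    Σ (map (λ p → Σ (map g (map (_∷ p) (stepsBelow M)))) (candidates n M))
      ≈⟨ Σ-map-concatMap g _ (candidates n M) ⟨
    Σ (map g (candidates (suc n) M))
      ∎
    where
    extend : ∀ p → Σ (map f (map (_∷ p) (stepsBelow M))) ≈ Σ (map g (map (_∷ p) (stepsBelow M)))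
    extend p = trans (Σ-map-∷-stepsBelow f p M)
                     (trans (sumSteps-cong M (λ h c → e h c p)) (sym (Σ-map-∷-stepsBelow g p M)))

module Transfer {c ℓ} (K : CommutativeSemiring c ℓ) (s t u : CommutativeSemiring.Carrier K) where
  open GF K
  open FiniteSums K
  open import Algebra.Properties.CommutativeSemigroup *-commutativeSemigroup
    using () renaming (interchange to *-interchange)
  open import Relation.Binary.Reasoning.Setoid setoid
  open CommutativeMonoidSolver *-commutativeMonoid using (solve; _⊜_) renaming (_⊕_ to _⊗_; id to ε)

  data Family : Set where
    fam𝒜 famℬ famℛ : Family

  member : Family → CPath → Bool
  member fam𝒜 p = isDyck p ∧ (c1 p ∧ c2 p)
  member famℬ p = isDyck p ∧ (c2 p ∧ firstIs black p)
  member famℛ p = isDyck p ∧ (c2 p ∧ firstIs red p)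

  paths : Family → ℕ → List CPath
  paths fam𝒜 = 𝒜
  paths famℬ = ℬ
  paths famℛ = ℛ

  gfOf : Family → Carrier → Series
  gfOf k = gf (paths k) s t u

  height : Maybe Step → ℕ
  height nothing        = 0
  height (just (h , _)) = h

  height? : Maybe Step → Maybe ℕ
  height? nothing        = nothing
  height? (just (h , _)) = just h

  turnBefore : Maybe Step → ℕ → ℕ
  turnBefore nothing         h = 0
  turnBefore (just (h' , _)) h = b2n (h' <ᵇ h)

  c1Step : Family → Step → Bool
  c1Step fam𝒜 (h , c) = if h ≡ᵇ 0 then isRed c else true
  c1Step famℬ _       = true
  c1Step famℛ _       = true

  c2Step : Maybe Step → Step → Bool
  c2Step prev (h , c) = if (0 <ᵇ h) ∧ newHeight (height? prev) h then isBlack c else true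

  firstColourOk : Family → Maybe Step → Colour → Bool
  firstColourOk _    (just _) _ = true
  firstColourOk fam𝒜 nothing  _ = true
  firstColourOk famℬ nothing  c = isBlack c
  firstColourOk famℛ nothing  c = isRed c

  -- j is the 0-based position of the step: the Dyck condition reads h ≤ j, and the step
  -- touches the diagonal iff h = j.
  admissible : Family → ℕ → Maybe Step → Step → Bool
  admissible k j prev (h , c) =
    (height prev ≤ᵇ h)
    ∧ ((h <ᵇ suc j) ∧ (c1Step k (h , c) ∧ (c2Step prev (h , c) ∧ firstColourOk k prev c)))

  stepWeight : Carrier → ℕ → Maybe Step → Step → Carrier
  stepWeight v j prev (h , c) =
    pow s (turnBefore prev h)
    * (pow t (b2n (startsSeg prev (h , c))) * (pow u (b2n (isRed c)) * pow v (b2n (h ≡ᵇ j))))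

  factor : Family → Carrier → ℕ → Maybe Step → Step → Carrier
  factor k v j prev x = if admissible k j prev x then stepWeight v j prev x else 0#

  pathFactor : Family → Carrier → ℕ → Maybe Step → CPath → Carrier
  pathFactor k v j prev []      = 1#
  pathFactor k v j prev (x ∷ p) = factor k v j prev x * pathFactor k v (suc j) (just x) p

  transfer : Family → Carrier → ℕ → ℕ → Maybe Step → ℕ → Carrier
  transfer k v M j prev zero    = 1#
  transfer k v M j prev (suc n) = sumSteps M (λ x → factor k v j prev x * transfer k v M (suc j) (just x) n)

  Σ-pathFactor-candidates : ∀ k v M n j prev →
    Σ (map (pathFactor k v j prev) (candidates n M)) ≈ transfer k v M j prev n
  Σ-pathFactor-candidates k v M zero    j prev = +-identityʳ 1#
  Σ-pathFactor-candidates k v M (suc n) j prev = begin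
    Σ (map (pathFactor k v j prev) (concatMap (λ p → map (_∷ p) (stepsBelow M)) (candidates n M)))
      ≈⟨ Σ-map-concatMap _ _ (candidates n M) ⟩
    Σ (map (λ p → Σ (map (pathFactor k v j prev) (map (_∷ p) (stepsBelow M)))) (candidates n M))
      ≈⟨ Σ-map-cong (candidates n M) (λ p → Σ-map-∷-stepsBelow (pathFactor k v j prev) p M) ⟩
    Σ (map (λ p → sumSteps M (λ x → extend x p)) (candidates n M))
      ≈⟨ Σ-map-sumBelow _ (candidates n M) M ⟩
    sumBelow (λ h → Σ (map (λ p → extend (h , black) p + extend (h , red) p) (candidates n M))) M
      ≈⟨ sumBelow-cong M (λ h _ → trans (Σ-map-+ _ _ (candidates n M))
                                        (+-cong (rest (h , black)) (rest (h , red)))) ⟩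
    transfer k v M j prev (suc n)
      ∎
    where
    extend : Step → CPath → Carrier
    extend x p = factor k v j prev x * pathFactor k v (suc j) (just x) p
    rest : ∀ x → Σ (map (extend x) (candidates n M)) ≈ factor k v j prev x * transfer k v M (suc j) (just x) n
    rest x = trans (sym (*-distribˡ-Σ-map _ _ (candidates n M)))
                   (*-congˡ (Σ-pathFactor-candidates k v M n (suc j) (just x)))

  admissiblePath : Family → ℕ → Maybe Step → CPath → Bool
  admissiblePath k j prev []      = true
  admissiblePath k j prev (x ∷ p) = admissible k j prev x ∧ admissiblePath k (suc j) (just x) p

  turnsAfter : Maybe Step → CPath → ℕ
  turnsAfter prev []            = 0
  turnsAfter prev ((h , c) ∷ p) = turnBefore prev h ℕ.+ turnsAfter (just (h , c)) p

  pathWeight : Carrier → ℕ → Maybe Step → CPath → Carrier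
  pathWeight v j prev p =
    pow s (turnsAfter prev p) * (pow t (segAux prev p) * (pow u (red# p) * pow v (retAux j p)))

  pow-+ : ∀ x m n → pow x (m ℕ.+ n) ≈ pow x m * pow x n
  pow-+ x zero    n = sym (*-identityˡ _)
  pow-+ x (suc m) n = trans (*-congˡ (pow-+ x m n)) (sym (*-assoc _ _ _))

  pathWeight-∷ : ∀ v j prev h c p →
    pathWeight v j prev ((h , c) ∷ p) ≈ stepWeight v j prev (h , c) * pathWeight v (suc j) (just (h , c)) p
  pathWeight-∷ v j prev h c p = begin
    pathWeight v j prev ((h , c) ∷ p)
      ≈⟨ *-cong (pow-+ s (turnBefore prev h) _) (*-cong (pow-+ t (b2n (startsSeg prev (h , c))) _)
                (*-cong (pow-+ u (b2n (isRed c)) _) (pow-+ v (b2n (h ≡ᵇ j)) _))) ⟩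
    (s₁ * s₂) * ((t₁ * t₂) * ((u₁ * u₂) * (v₁ * v₂)))
      ≈⟨ *-congˡ (*-congˡ (*-interchange u₁ u₂ v₁ v₂)) ⟩
    (s₁ * s₂) * ((t₁ * t₂) * ((u₁ * v₁) * (u₂ * v₂)))
      ≈⟨ *-congˡ (*-interchange t₁ t₂ _ _) ⟩
    (s₁ * s₂) * ((t₁ * (u₁ * v₁)) * (t₂ * (u₂ * v₂)))
      ≈⟨ *-interchange s₁ s₂ _ _ ⟩
    stepWeight v j prev (h , c) * pathWeight v (suc j) (just (h , c)) p
      ∎
    where
    s₁ s₂ t₁ t₂ u₁ u₂ v₁ v₂ : Carrier
    s₁ = pow s (turnBefore prev h)
    s₂ = pow s (turnsAfter (just (h , c)) p)
    t₁ = pow t (b2n (startsSeg prev (h , c)))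
    t₂ = pow t (segAux (just (h , c)) p)
    u₁ = pow u (b2n (isRed c))
    u₂ = pow u (red# p)
    v₁ = pow v (b2n (h ≡ᵇ j))
    v₂ = pow v (retAux (suc j) p)

  pathFactor-admissible : ∀ k v j prev p →
    (if admissiblePath k j prev p then pathWeight v j prev p else 0#) ≈ pathFactor k v j prev p
  pathFactor-admissible k v j prev [] = trans (*-identityˡ _) (trans (*-identityˡ _) (*-identityˡ _))
  pathFactor-admissible k v j prev ((h , c) ∷ p) with admissible k j prev (h , c)
  ... | false = sym (zeroˡ _)
  ... | true with admissiblePath k (suc j) (just (h , c)) p | pathFactor-admissible k v (suc j) (just (h , c)) p
  ...   | true  | ih = trans (pathWeight-∷ v j prev h c p) (*-congˡ ih)
  ...   | false | ih = trans (sym (zeroʳ _)) (*-congˡ ih)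

  requiresC1 : Family → CPath → Bool
  requiresC1 fam𝒜 p = c1 p
  requiresC1 famℬ p = true
  requiresC1 famℛ p = true

  requiresC1-∷ : ∀ k h c p → requiresC1 k ((h , c) ∷ p) ≡ c1Step k (h , c) ∧ requiresC1 k p
  requiresC1-∷ fam𝒜 h c p = ≡.refl
  requiresC1-∷ famℬ h c p = ≡.refl
  requiresC1-∷ famℛ h c p = ≡.refl

  dyck-admissible : ∀ k j y p →
    dyckAux (suc j) (height (just y)) p ∧ (requiresC1 k p ∧ c2Aux (height? (just y)) p)
      ≡ admissiblePath k j (just y) p
  dyck-admissible fam𝒜 j y [] = ≡.refl
  dyck-admissible famℬ j y [] = ≡.refl
  dyck-admissible famℛ j y [] = ≡.refl
  dyck-admissible k j (hy , cy) ((h , c) ∷ p) rewrite requiresC1-∷ k h c p =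
    ≡.trans (∧-interleave (hy ≤ᵇ h) (h <ᵇ suc j) (c1Step k (h , c)) _ _ _ _)
            (≡.cong (admissible k j (just (hy , cy)) (h , c) ∧_) (dyck-admissible k (suc j) (h , c) p))

  member-admissible : ∀ k h c p → member k ((h , c) ∷ p) ≡ admissiblePath k 0 nothing ((h , c) ∷ p)
  member-admissible fam𝒜 h c p =
    ≡.trans (∧-interleave true (h <ᵇ 1) (c1Step fam𝒜 (h , c)) (c2Step nothing (h , c)) (dyckAux 2 h p) _ _)
            (≡.cong (admissible fam𝒜 0 nothing (h , c) ∧_) (dyck-admissible fam𝒜 1 (h , c) p))
  member-admissible famℬ h c p =
    ≡.trans (∧-interleave′ true (h <ᵇ 1) (c2Step nothing (h , c)) (isBlack c) (dyckAux 2 h p) _)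
            (≡.cong (admissible famℬ 0 nothing (h , c) ∧_) (dyck-admissible famℬ 1 (h , c) p))
  member-admissible famℛ h c p =
    ≡.trans (∧-interleave′ true (h <ᵇ 1) (c2Step nothing (h , c)) (isRed c) (dyckAux 2 h p) _)
            (≡.cong (admissible famℛ 0 nothing (h , c) ∧_) (dyck-admissible famℛ 1 (h , c) p))

  member⇒isDyck : ∀ k p → member k p ≡ true → isDyck p ≡ true
  member⇒isDyck fam𝒜 p e = proj₁ (∧-true e)
  member⇒isDyck famℬ p e = proj₁ (∧-true e)
  member⇒isDyck famℛ p e = proj₁ (∧-true e)

  dyck-∷ : ∀ i prev h {c} p → dyckAux i prev ((h , c) ∷ p) ≡ true →
    (h <ᵇ i) ≡ true × dyckAux (suc i) h p ≡ true
  dyck-∷ i prev h p dyck = ∧-true {h <ᵇ i} (proj₂ (∧-true {prev ≤ᵇ h} dyck))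

  -- In a Dyck path the last east step is always followed by a north step, and `turn` discards it.
  turnCount-dyck : ∀ i prev h c p n → dyckAux i prev ((h , c) ∷ p) ≡ true → i ℕ.+ length p ≤ n →
    turnCount n ((h , c) ∷ p) ≡ suc (turnsAfter (just (h , c)) p)
  turnCount-dyck i prev h c [] n dyck i≤n
    rewrite <ᵇ-≤-trans h i n (proj₁ (dyck-∷ i prev h {c} [] dyck)) (≡.subst (_≤ n) (ℕₚ.+-identityʳ i) i≤n)
    = ≡.refl
  turnCount-dyck i prev h c ((h′ , c′) ∷ p) n dyck i+p≤n =
    ≡.trans (≡.cong (b2n (h <ᵇ h′) ℕ.+_)
                    (turnCount-dyck (suc i) h h′ c′ p n (proj₂ (dyck-∷ i prev h {c} ((h′ , c′) ∷ p) dyck))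
                                    (≡.subst (_≤ n) (+-suc i (length p)) i+p≤n)))
            (+-suc _ _)

  weight-pathFactor : ∀ k v h c p →
    (if member k ((h , c) ∷ p) then weight s t u v ((h , c) ∷ p) else 0#)
      ≈ pathFactor k v 0 nothing ((h , c) ∷ p)
  weight-pathFactor k v h c p
    with member k ((h , c) ∷ p) in eq | pathFactor-admissible k v 0 nothing ((h , c) ∷ p)
  ... | true  | bridge rewrite ≡.trans (≡.sym (member-admissible k h c p)) eq
                             | turnCount-dyck 1 0 h c p (suc (length p)) (member⇒isDyck k _ eq) ≤-refl = bridge
  ... | false | bridge rewrite ≡.trans (≡.sym (member-admissible k h c p)) eq = bridge

  gfOf-transfer : ∀ k v n → gfOf k v (suc n) ≈ transfer k v (suc n) 0 nothing (suc n)
  gfOf-transfer k v n = begin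
    gfOf k v (suc n)
      ≡⟨ gfOf-filter k ⟩
    Σ (map (weight s t u v) (filterᵇ (member k) (candidates (suc n) (suc n))))
      ≈⟨ Σ-map-filterᵇ _ (member k) (candidates (suc n) (suc n)) ⟩
    Σ (map (λ p → if member k p then weight s t u v p else 0#) (candidates (suc n) (suc n)))
      ≈⟨ Σ-candidates-cong∷ n (suc n) (weight-pathFactor k v) ⟩
    Σ (map (pathFactor k v 0 nothing) (candidates (suc n) (suc n)))
      ≈⟨ Σ-pathFactor-candidates k v (suc n) (suc n) 0 nothing ⟩
    transfer k v (suc n) 0 nothing (suc n)
      ∎
    where
    gfOf-filter : ∀ k →
      gfOf k v (suc n) ≡ Σ (map (weight s t u v) (filterᵇ (member k) (candidates (suc n) (suc n))))
    gfOf-filter fam𝒜 = ≡.refl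
    gfOf-filter famℬ = ≡.refl
    gfOf-filter famℛ = ≡.refl

  factor-aboveDiagonal : ∀ k v j prev h c → (h <ᵇ suc j) ≡ false → factor k v j prev (h , c) ≈ 0#
  factor-aboveDiagonal k v j prev h c h>j rewrite h>j | ∧-zeroʳ (height prev ≤ᵇ h) = refl

  factor-belowPrevious : ∀ k v j prev h c → (height prev ≤ᵇ h) ≡ false → factor k v j prev (h , c) ≈ 0#
  factor-belowPrevious k v j prev h c h<prev rewrite h<prev = refl

  transfer-extend : ∀ k v M d n j prev → j ℕ.+ n ≤ M →
    transfer k v (M ℕ.+ d) j prev n ≈ transfer k v M j prev n
  transfer-extend k v M d zero    j prev _   = refl
  transfer-extend k v M d (suc n) j prev j+n<M = begin
    sumSteps (M ℕ.+ d) extended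
      ≈⟨ sumBelow-split _ M d ⟩
    sumSteps M extended + sumBelow (λ h → extended (M ℕ.+ h , black) + extended (M ℕ.+ h , red)) d
      ≈⟨ +-cong (sumSteps-cong M {extended} (λ h c →
                   *-congˡ (transfer-extend k v M d n (suc j) (just (h , c)) j+n<M′)))
                (sumBelow-zero d (λ h _ →
                   trans (+-cong (tooHigh h black) (tooHigh h red)) (+-identityˡ 0#))) ⟩
    transfer k v M j prev (suc n) + 0#
      ≈⟨ +-identityʳ _ ⟩
    transfer k v M j prev (suc n)
      ∎
    where
    extended : Step → Carrier
    extended x = factor k v j prev x * transfer k v (M ℕ.+ d) (suc j) (just x) n
    j+n<M′ : suc j ℕ.+ n ≤ M
    j+n<M′ = ≡.subst (_≤ M) (+-suc j n) j+n<M
    j<M : suc j ≤ M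
    j<M = ≤-trans (s≤s (m≤m+n j n)) j+n<M′
    tooHigh : ∀ h c → extended (M ℕ.+ h , c) ≈ 0#
    tooHigh h c = trans (*-congʳ (factor-aboveDiagonal k v j prev (M ℕ.+ h) c
                          (≤⇒≮ᵇ (M ℕ.+ h) (suc j) (≤-trans j<M (m≤m+n M h)))))
                        (zeroˡ _)

  transfer-bound-irrelevant : ∀ k v M M′ n j prev → j ℕ.+ n ≤ M → j ℕ.+ n ≤ M′ →
    transfer k v M j prev n ≈ transfer k v M′ j prev n
  transfer-bound-irrelevant k v M M′ n j prev j+n≤M j+n≤M′ with ≤-total M M′
  ... | inj₁ M≤M′ with m≤n⇒∃[o]m+o≡n M≤M′
  ...   | d , ≡.refl = sym (transfer-extend k v M d n j prev j+n≤M)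
  transfer-bound-irrelevant k v M M′ n j prev j+n≤M j+n≤M′ | inj₂ M′≤M with m≤n⇒∃[o]m+o≡n M′≤M
  ...   | d , ≡.refl = transfer-extend k v M′ d n j prev j+n≤M′

  transfer-first : ∀ k v M n prev → 1 ≤ M →
    transfer k v M 0 prev (suc n)
      ≈ factor k v 0 prev (0 , black) * transfer k v M 1 (just (0 , black)) n
        + factor k v 0 prev (0 , red) * transfer k v M 1 (just (0 , red)) n
  transfer-first k v M n prev 1≤M = sumSteps-single _ 0 M 1≤M positive
    where
    positive : ∀ h c → (h ≡ᵇ 0) ≡ false →
      factor k v 0 prev (h , c) * transfer k v M 1 (just (h , c)) n ≈ 0#
    positive (suc h) c _ = trans (*-congʳ (factor-aboveDiagonal k v 0 prev (suc h) c ≡.refl)) (zeroˡ _)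

  returning nonReturning : Family → Carrier → ℕ → Maybe Step → Step → Carrier
  returning    k v j prev (h , c) = if h ≡ᵇ j then factor k v j prev (h , c) else 0#
  nonReturning k v j prev (h , c) = if h ≡ᵇ j then 0# else factor k v j prev (h , c)

  factor-split : ∀ k v j prev h c →
    factor k v j prev (h , c) ≈ returning k v j prev (h , c) + nonReturning k v j prev (h , c)
  factor-split k v j prev h c with h ≡ᵇ j
  ... | true  = sym (+-identityʳ _)
  ... | false = sym (+-identityˡ _)

  strictTransfer : Family → Carrier → ℕ → ℕ → Maybe Step → ℕ → Carrier
  strictTransfer k v M j prev zero    = 1#
  strictTransfer k v M j prev (suc a) =
    sumSteps M (λ x → nonReturning k v j prev x * strictTransfer k v M (suc j) (just x) a)

  returnTransfer : Family → Carrier → ℕ → ℕ → Maybe Step → ℕ → Carrier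
  returnTransfer k v M j prev zero    = 1#
  returnTransfer k v M j prev (suc b) =
    sumSteps M (λ x → returning k v j prev x * transfer k v M (suc j) (just x) b)

  -- a steps off the diagonal, then (if b > 0) a return followed by b - 1 arbitrary steps
  firstReturnAfter : Family → Carrier → ℕ → ℕ → Maybe Step → ℕ → ℕ → Carrier
  firstReturnAfter k v M j prev zero    b = returnTransfer k v M j prev b
  firstReturnAfter k v M j prev (suc a) b =
    sumSteps M (λ x → nonReturning k v j prev x * firstReturnAfter k v M (suc j) (just x) a b)

  transfer-firstReturn : ∀ k v M n j prev →
    transfer k v M j prev n ≈ sumBelow (λ a → firstReturnAfter k v M j prev a (n ∸ a)) (suc n)
  transfer-firstReturn k v M zero    j prev = sym (+-identityʳ _)
  transfer-firstReturn k v M (suc n) j prev = begin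
    transfer k v M j prev (suc n)
      ≈⟨ sumSteps-cong M {g = λ x → viaReturn x + viaStrict x}
           (λ h c → trans (*-congʳ (factor-split k v j prev h c)) (distribʳ _ _ _)) ⟩
    sumSteps M (λ x → viaReturn x + viaStrict x)
      ≈⟨ sumSteps-+ M viaReturn viaStrict ⟩
    returnTransfer k v M j prev (suc n) + sumSteps M viaStrict
      ≈⟨ +-congˡ (sumSteps-cong M {g = λ x → sumBelow (λ a → later a x) (suc n)}
           (λ h c → trans (*-congˡ (transfer-firstReturn k v M n (suc j) (just (h , c))))
                          (*-distribˡ-sumBelow _ (λ a → firstReturnAfter k v M (suc j) (just (h , c)) a (n ∸ a))
                                                 (suc n)))) ⟩
    returnTransfer k v M j prev (suc n) + sumSteps M (λ x → sumBelow (λ a → later a x) (suc n))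
      ≈⟨ +-congˡ (sumBelow-cong M (λ h _ →
           sym (sumBelow-+ (λ a → later a (h , black)) (λ a → later a (h , red)) (suc n)))) ⟩
    returnTransfer k v M j prev (suc n)
      + sumBelow (λ h → sumBelow (λ a → later a (h , black) + later a (h , red)) (suc n)) M
      ≈⟨ +-congˡ (sumBelow-swap (λ a h → later a (h , black) + later a (h , red)) (suc n) M) ⟨
    sumBelow (λ a → firstReturnAfter k v M j prev a (suc n ∸ a)) (suc (suc n))
      ∎
    where
    viaReturn viaStrict : Step → Carrier
    viaReturn x = returning k v j prev x * transfer k v M (suc j) (just x) n
    viaStrict x = nonReturning k v j prev x * transfer k v M (suc j) (just x) n
    later : ℕ → Step → Carrier
    later a x = nonReturning k v j prev x * firstReturnAfter k v M (suc j) (just x) a (n ∸ a)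

  c1Step-positive : ∀ k h c → c1Step k (suc h , c) ≡ true
  c1Step-positive fam𝒜 h c = ≡.refl
  c1Step-positive famℬ h c = ≡.refl
  c1Step-positive famℛ h c = ≡.refl

  c2Step-shift : ∀ a h′ c′ h c → (h′ ≤ᵇ h) ≡ true →
    c2Step (just (suc a ℕ.+ h′ , c′)) (suc a ℕ.+ h , c) ≡ c2Step (just (h′ , c′)) (h , c)
  c2Step-shift a zero     c′ zero    c _ rewrite +-cancelˡ-≡ᵇ a 0 0 = ≡.refl
  c2Step-shift a (suc h′) c′ zero    c ()
  c2Step-shift a h′       c′ (suc h) c _ =
    ≡.cong (λ b → if not b then isBlack c else true) (+-cancelˡ-≡ᵇ a h′ (suc h))

  -- Away from height 0, a step is judged like a step of a ℬ-path translated diagonally.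
  admissible-shift : ∀ k a j h′ c′ h c →
    admissible k (suc a ℕ.+ j) (just (suc a ℕ.+ h′ , c′)) (suc a ℕ.+ h , c)
      ≡ admissible famℬ j (just (h′ , c′)) (h , c)
  admissible-shift k a j h′ c′ h c rewrite +-cancelˡ-≤ᵇ (suc a) h′ h with h′ ≤ᵇ h in h′≤h
  ... | false = ≡.refl
  ... | true  = ≡.cong₂ _∧_ below (≡.cong₂ _∧_ (c1Step-positive k (a ℕ.+ h) c)
                                               (≡.cong (_∧ true) (c2Step-shift a h′ c′ h c h′≤h)))
    where
    below : (suc a ℕ.+ h <ᵇ suc (suc a ℕ.+ j)) ≡ (h <ᵇ suc j)
    below = ≡.trans (≡.cong (suc a ℕ.+ h <ᵇ_) (≡.sym (+-suc (suc a) j))) (+-cancelˡ-<ᵇ (suc a) h (suc j))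

  stepWeight-shift : ∀ v a j h′ c′ h c →
    stepWeight v (a ℕ.+ j) (just (a ℕ.+ h′ , c′)) (a ℕ.+ h , c)
      ≡ stepWeight v j (just (h′ , c′)) (h , c)
  stepWeight-shift v a j h′ c′ h c
    rewrite +-cancelˡ-<ᵇ a h′ h | +-cancelˡ-≡ᵇ a h′ h | +-cancelˡ-≡ᵇ a h j = ≡.refl

  factor-shift : ∀ k v a j h′ c′ h c →
    factor k v (suc a ℕ.+ j) (just (suc a ℕ.+ h′ , c′)) (suc a ℕ.+ h , c)
      ≈ factor famℬ v j (just (h′ , c′)) (h , c)
  factor-shift k v a j h′ c′ h c = reflexive (≡.cong₂ (λ b w → if b then w else 0#)
    (admissible-shift k a j h′ c′ h c) (stepWeight-shift v (suc a) j h′ c′ h c))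

  transfer-shift : ∀ k v a M n j h′ c′ →
    transfer k v (suc a ℕ.+ M) (suc a ℕ.+ j) (just (suc a ℕ.+ h′ , c′)) n
      ≈ transfer famℬ v M j (just (h′ , c′)) n
  transfer-shift k v a M zero    j h′ c′ = refl
  transfer-shift k v a M (suc n) j h′ c′ = begin
    sumSteps (suc a ℕ.+ M) shifted
      ≈⟨ sumBelow-split (λ h → shifted (h , black) + shifted (h , red)) (suc a) M ⟩
    sumSteps (suc a) shifted
    + sumBelow (λ h → shifted (suc a ℕ.+ h , black) + shifted (suc a ℕ.+ h , red)) M
      ≈⟨ +-cong (sumBelow-zero (suc a) (λ h h<a →
                   trans (+-cong (tooLow h black h<a) (tooLow h red h<a)) (+-identityˡ 0#)))
                (sumSteps-cong M {λ x → shifted (suc a ℕ.+ proj₁ x , proj₂ x)} translate) ⟩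
    0# + transfer famℬ v M j (just (h′ , c′)) (suc n)
      ≈⟨ +-identityˡ _ ⟩
    transfer famℬ v M j (just (h′ , c′)) (suc n)
      ∎
    where
    shifted : Step → Carrier
    shifted x = factor k v (suc a ℕ.+ j) (just (suc a ℕ.+ h′ , c′)) x
                * transfer k v (suc a ℕ.+ M) (suc (suc a ℕ.+ j)) (just x) n
    tooLow : ∀ h c → suc h ≤ suc a → shifted (h , c) ≈ 0#
    tooLow h c h≤a = trans (*-congʳ (factor-belowPrevious k v _ (just (suc a ℕ.+ h′ , c′)) h c
                             (≤⇒≮ᵇ (suc a ℕ.+ h′) (suc h) (≤-trans h≤a (m≤m+n (suc a) h′)))))
                           (zeroˡ _)
    translate : ∀ h c → shifted (suc a ℕ.+ h , c)
                        ≈ factor famℬ v j (just (h′ , c′)) (h , c) * transfer famℬ v M (suc j) (just (h , c)) n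
    translate h c = *-cong (factor-shift k v a j h′ c′ h c)
      (≡.subst (λ i → transfer k v (suc a ℕ.+ M) i (just (suc a ℕ.+ h , c)) n
                      ≈ transfer famℬ v M (suc j) (just (h , c)) n)
               (+-suc (suc a) j) (transfer-shift k v a M n (suc j) h c))

  firstColour : Family → Colour
  firstColour fam𝒜 = red
  firstColour famℬ = black
  firstColour famℛ = red

  firstWeight : Family → Carrier → Carrier
  firstWeight fam𝒜 v = u * v
  firstWeight famℬ v = t * v
  firstWeight famℛ v = u * v

  gfOf-first : ∀ k v n →
    gfOf k v (suc n) ≈ firstWeight k v * transfer k v (suc n) 1 (just (0 , firstColour k)) n
  gfOf-first k v n =
    trans (gfOf-transfer k v n) (trans (transfer-first k v (suc n) n nothing (s≤s z≤n)) (first k))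
    where
    black-weight : 1# * ((t * 1#) * (1# * (v * 1#))) ≈ t * v
    black-weight = solve 2 (λ t v → ε ⊗ ((t ⊗ ε) ⊗ (ε ⊗ (v ⊗ ε))) ⊜ t ⊗ v) refl t v
    red-weight : 1# * (1# * ((u * 1#) * (v * 1#))) ≈ u * v
    red-weight = solve 2 (λ u v → ε ⊗ (ε ⊗ ((u ⊗ ε) ⊗ (v ⊗ ε))) ⊜ u ⊗ v) refl u v
    first : ∀ k → factor k v 0 nothing (0 , black) * transfer k v (suc n) 1 (just (0 , black)) n
                  + factor k v 0 nothing (0 , red) * transfer k v (suc n) 1 (just (0 , red)) n
                ≈ firstWeight k v * transfer k v (suc n) 1 (just (0 , firstColour k)) n
    first fam𝒜 = trans (+-congʳ (zeroˡ _)) (trans (+-identityˡ _) (*-congʳ red-weight))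
    first famℬ = trans (+-congˡ (zeroˡ _)) (trans (+-identityʳ _) (*-congʳ black-weight))
    first famℛ = trans (+-congʳ (zeroˡ _)) (trans (+-identityˡ _) (*-congʳ red-weight))

  returning-black : ∀ k v j h′ c′ → (h′ <ᵇ suc j) ≡ true →
    returning k v (suc j) (just (h′ , c′)) (suc j , black) ≈ s * (t * v)
  returning-black k v j h′ c′ h′≤j
    rewrite ≡ᵇ-refl j | <ᵇ⇒≤ᵇ h′ (suc j) h′≤j | n<ᵇ1+n j | c1Step-positive k j black
          | <ᵇ⇒≢ᵇ h′ (suc j) h′≤j | h′≤j | ∨-zeroʳ (not (isBlack c′)) =
    solve 3 (λ s t v → (s ⊗ ε) ⊗ ((t ⊗ ε) ⊗ (ε ⊗ (v ⊗ ε))) ⊜ s ⊗ (t ⊗ v)) refl s t v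

  returning-red : ∀ k v j h′ c′ → (h′ <ᵇ suc j) ≡ true →
    returning k v (suc j) (just (h′ , c′)) (suc j , red) ≈ 0#
  returning-red k v j h′ c′ h′≤j
    rewrite ≡ᵇ-refl j | <ᵇ⇒≤ᵇ h′ (suc j) h′≤j | n<ᵇ1+n j | c1Step-positive k j red
          | <ᵇ⇒≢ᵇ h′ (suc j) h′≤j = refl

  returnTransfer-suc : ∀ k v M j h′ c′ b → (h′ <ᵇ suc j) ≡ true → suc (suc j) ≤ M →
    returnTransfer k v M (suc j) (just (h′ , c′)) (suc b)
      ≈ (s * (t * v)) * transfer k v M (suc (suc j)) (just (suc j , black)) b
  returnTransfer-suc k v M j h′ c′ b h′≤j j<M = begin
    sumSteps M returnThen
      ≈⟨ sumSteps-single returnThen (suc j) M j<M offDiagonal ⟩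
    returnThen (suc j , black) + returnThen (suc j , red)
      ≈⟨ +-cong (*-congʳ (returning-black k v j h′ c′ h′≤j))
                (trans (*-congʳ (returning-red k v j h′ c′ h′≤j)) (zeroˡ _)) ⟩
    (s * (t * v)) * transfer k v M (suc (suc j)) (just (suc j , black)) b + 0#
      ≈⟨ +-identityʳ _ ⟩
    (s * (t * v)) * transfer k v M (suc (suc j)) (just (suc j , black)) b
      ∎
    where
    returnThen : Step → Carrier
    returnThen x = returning k v (suc j) (just (h′ , c′)) x * transfer k v M (suc (suc j)) (just x) b
    offDiagonal : ∀ h c → (h ≡ᵇ suc j) ≡ false → returnThen (h , c) ≈ 0#
    offDiagonal h c h≢j rewrite h≢j = zeroˡ _

  returnTransfer-afterReturn : ∀ k v M j h′ c′ b → (h′ <ᵇ j) ≡ true → j ℕ.+ b ≤ M →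
    returnTransfer k v M j (just (h′ , c′)) b ≈ (one ⊕ s · B s t u v) b
  returnTransfer-afterReturn k v M j h′ c′ zero _ _ = sym (trans (+-congˡ (zeroʳ s)) (+-identityʳ 1#))
  returnTransfer-afterReturn k v M (suc j) h′ c′ (suc b) h′≤j j+b<M = begin
    returnTransfer k v M (suc j) (just (h′ , c′)) (suc b)
      ≈⟨ returnTransfer-suc k v M j h′ c′ b h′≤j (≤-trans (m≤m+n (suc (suc j)) b) j+b<M′) ⟩
    (s * (t * v)) * transfer k v M (suc (suc j)) (just (suc j , black)) b
      ≈⟨ *-congˡ (transfer-bound-irrelevant k v M _ b _ _ j+b<M′
                   (≤-reflexive (≡.cong suc (≡.sym (+-suc j b))))) ⟩
    (s * (t * v)) * transfer k v (suc j ℕ.+ suc b) (suc (suc j)) (just (suc j , black)) b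
      ≈⟨ *-congˡ translated ⟩
    (s * (t * v)) * transfer famℬ v (suc b) 1 (just (0 , black)) b
      ≈⟨ trans (*-assoc s (t * v) _) (*-congˡ (sym (gfOf-first famℬ v b))) ⟩
    s * B s t u v (suc b)
      ≈⟨ +-identityˡ _ ⟨
    (one ⊕ s · B s t u v) (suc b)
      ∎
    where
    j+b<M′ : suc (suc j) ℕ.+ b ≤ M
    j+b<M′ = ≡.subst (_≤ M) (≡.cong suc (+-suc j b)) j+b<M
    translated : transfer k v (suc j ℕ.+ suc b) (suc (suc j)) (just (suc j , black)) b
                 ≈ transfer famℬ v (suc b) 1 (just (0 , black)) b
    translated = ≡.subst₂ (λ i h → transfer k v (suc j ℕ.+ suc b) i (just (h , black)) b
                                   ≈ transfer famℬ v (suc b) 1 (just (0 , black)) b)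
                          (ℕₚ.+-comm (suc j) 1) (ℕₚ.+-identityʳ (suc j))
                          (transfer-shift k v j (suc b) b 1 0 black)

  pow-1# : ∀ n → pow 1# n ≈ 1#
  pow-1# zero    = refl
  pow-1# (suc n) = trans (*-identityˡ _) (pow-1# n)

  if-zero : ∀ b {x} → x ≈ 0# → (if b then 0# else x) ≈ 0#
  if-zero true  _    = refl
  if-zero false x≈0 = x≈0

  if-congʳ : ∀ b {x y} → x ≈ y → (if b then x else 0#) ≈ (if b then y else 0#)
  if-congʳ true  x≈y = x≈y
  if-congʳ false _   = refl

  -- Off the diagonal the weight v never occurs, and position j + 1 admits the same steps as position j.
  nonReturning-lower : ∀ k v j prev h c → nonReturning k v (suc j) prev (h , c) ≈ factor k 1# j prev (h , c)
  nonReturning-lower k v j prev h c = compare (h <ᵇ suc j) ≡.refl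
    where
    compare : ∀ b → (h <ᵇ suc j) ≡ b →
      nonReturning k v (suc j) prev (h , c) ≈ factor k 1# j prev (h , c)
    compare true h≤j rewrite <ᵇ⇒≢ᵇ h (suc j) h≤j | m<ᵇn⇒m<ᵇ1+n h (suc j) h≤j | h≤j =
      if-congʳ _ (*-congˡ (*-congˡ (*-congˡ (sym (pow-1# (b2n (h ≡ᵇ j)))))))
    compare false h>j =
      trans (onOrAbove (h ≡ᵇ suc j) ≡.refl) (sym (factor-aboveDiagonal k 1# j prev h c h>j))
      where
      onOrAbove : ∀ b → (h ≡ᵇ suc j) ≡ b → nonReturning k v (suc j) prev (h , c) ≈ 0#
      onOrAbove true  h≡j rewrite h≡j = refl
      onOrAbove false h≢j = if-zero (h ≡ᵇ suc j)
        (factor-aboveDiagonal k v (suc j) prev h c (≮ᵇ-≢ᵇ⇒≮ᵇsuc h (suc j) h>j h≢j))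

  strictTransfer-lower : ∀ k v M a j prev → strictTransfer k v M (suc j) prev a ≈ transfer k 1# M j prev a
  strictTransfer-lower k v M zero    j prev = refl
  strictTransfer-lower k v M (suc a) j prev = sumSteps-cong M (λ h c →
    *-cong (nonReturning-lower k v j prev h c) (strictTransfer-lower k v M a (suc j) (just (h , c))))

  nonReturning-aboveDiagonal : ∀ k v j prev h c → (h <ᵇ suc j) ≡ false →
    nonReturning k v j prev (h , c) ≈ 0#
  nonReturning-aboveDiagonal k v j prev h c h>j = if-zero (h ≡ᵇ j) (factor-aboveDiagonal k v j prev h c h>j)

  firstReturnAfter-factorises : ∀ k v M a j h′ c′ b → (h′ <ᵇ j) ≡ true → j ℕ.+ a ℕ.+ b ≤ M →
    firstReturnAfter k v M j (just (h′ , c′)) a b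
      ≈ strictTransfer k v M j (just (h′ , c′)) a * (one ⊕ s · B s t u v) b
  firstReturnAfter-factorises k v M zero j h′ c′ b h′<j j+b≤M =
    trans (returnTransfer-afterReturn k v M j h′ c′ b h′<j
             (≡.subst (λ i → i ℕ.+ b ≤ M) (ℕₚ.+-identityʳ j) j+b≤M))
          (sym (*-identityˡ _))
  firstReturnAfter-factorises k v M (suc a) j h′ c′ b h′<j j+a+b≤M = begin
    sumSteps M (λ x → strictStep x * firstReturnAfter k v M (suc j) (just x) a b)
      ≈⟨ sumSteps-cong M (λ h c → factorise h c (h <ᵇ suc j) ≡.refl) ⟩
    sumSteps M (λ x → strictStep x * strictTransfer k v M (suc j) (just x) a * tail)
      ≈⟨ sumBelow-cong M (λ h _ → sym (distribʳ tail _ _)) ⟩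
    sumBelow (λ h → (strict (h , black) + strict (h , red)) * tail) M
      ≈⟨ *-distribʳ-sumBelow tail _ M ⟨
    strictTransfer k v M j (just (h′ , c′)) (suc a) * tail
      ∎
    where
    tail : Carrier
    tail = (one ⊕ s · B s t u v) b
    strictStep strict : Step → Carrier
    strictStep x = nonReturning k v j (just (h′ , c′)) x
    strict x = strictStep x * strictTransfer k v M (suc j) (just x) a
    j+a+b≤M′ : suc j ℕ.+ a ℕ.+ b ≤ M
    j+a+b≤M′ = ≡.subst (λ i → i ℕ.+ b ≤ M) (+-suc j a) j+a+b≤M
    factorise : ∀ h c β → (h <ᵇ suc j) ≡ β →
      strictStep (h , c) * firstReturnAfter k v M (suc j) (just (h , c)) a b ≈ strict (h , c) * tail
    factorise h c true h≤j =
      trans (*-congˡ (firstReturnAfter-factorises k v M a (suc j) h c b h≤j j+a+b≤M′)) (sym (*-assoc _ _ _))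
    factorise h c false h>j = begin
      strictStep (h , c) * firstReturnAfter k v M (suc j) (just (h , c)) a b
        ≈⟨ trans (*-congʳ noStep) (zeroˡ _) ⟩
      0#
        ≈⟨ trans (*-congʳ (trans (*-congʳ noStep) (zeroˡ _))) (zeroˡ tail) ⟨
      strict (h , c) * tail
        ∎
      where
      noStep : strictStep (h , c) ≈ 0#
      noStep = nonReturning-aboveDiagonal k v j (just (h′ , c′)) h c h>j

  transfer-afterFirst : ∀ k v n c₀ →
    transfer k v (suc n) 1 (just (0 , c₀)) n
      ≈ sumBelow (λ a → transfer k 1# (suc n) 0 (just (0 , c₀)) a * (one ⊕ s · B s t u v) (n ∸ a)) (suc n)
  transfer-afterFirst k v n c₀ = trans (transfer-firstReturn k v (suc n) n 1 (just (0 , c₀)))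
    (sumBelow-cong (suc n) (λ a a<n →
      trans (firstReturnAfter-factorises k v (suc n) a 1 0 c₀ (n ∸ a) ≡.refl (fits a<n))
            (*-congʳ (strictTransfer-lower k v (suc n) a 0 (just (0 , c₀))))))
    where
    fits : ∀ {a} → suc a ≤ suc n → 1 ℕ.+ a ℕ.+ (n ∸ a) ≤ suc n
    fits (s≤s a≤n) = ≤-reflexive (≡.cong suc (m+[n∸m]≡n a≤n))

  gfOf-firstReturn : ∀ k v n →
    gfOf k v (suc n)
      ≈ firstWeight k v
        * sumBelow (λ a → transfer k 1# (suc n) 0 (just (0 , firstColour k)) a * (one ⊕ s · B s t u v) (n ∸ a))
                   (suc n)
  gfOf-firstReturn k v n = trans (gfOf-first k v n) (*-congˡ (transfer-afterFirst k v n (firstColour k)))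

  transfer-ℬ≈ℛ : ∀ v M n j y → transfer famℬ v M j (just y) n ≈ transfer famℛ v M j (just y) n
  transfer-ℬ≈ℛ v M zero    j y = refl
  transfer-ℬ≈ℛ v M (suc n) j y =
    sumSteps-cong M {g = λ x → factor famℛ v j (just y) x * transfer famℛ v M (suc j) (just x) n}
      (λ h c → *-congˡ (transfer-ℬ≈ℛ v M n (suc j) (h , c)))

  transfer-𝒜-restart : ∀ v M n → transfer fam𝒜 v M 0 (just (0 , red)) n ≈ transfer fam𝒜 v M 0 nothing n
  transfer-𝒜-restart v M zero    = refl
  transfer-𝒜-restart v M (suc n) = sumSteps-cong M sameFactor
    where
    sameFactor : ∀ h c → factor fam𝒜 v 0 (just (0 , red)) (h , c) * transfer fam𝒜 v M 1 (just (h , c)) n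
                         ≈ factor fam𝒜 v 0 nothing (h , c) * transfer fam𝒜 v M 1 (just (h , c)) n
    sameFactor zero    black = refl
    sameFactor zero    red   = refl
    sameFactor (suc h) c     = *-congʳ (trans (factor-aboveDiagonal fam𝒜 v 0 (just (0 , red)) (suc h) c ≡.refl)
                                              (sym (factor-aboveDiagonal fam𝒜 v 0 nothing (suc h) c ≡.refl)))

  B-at-1 : ∀ a → B s t u 1# (suc a) ≈ t * transfer famℬ 1# (suc a) 1 (just (0 , black)) a
  B-at-1 a = trans (gfOf-first famℬ 1# a) (*-congʳ (*-identityʳ t))

  R-at-1 : ∀ a → R s t u 1# (suc a) ≈ u * transfer famℛ 1# (suc a) 1 (just (0 , red)) a
  R-at-1 a = trans (gfOf-first famℛ 1# a) (*-congʳ (*-identityʳ u))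

  redStep : 1# * (1# * ((u * 1#) * (1# * 1#))) ≈ u
  redStep = solve 1 (λ u → ε ⊗ (ε ⊗ ((u ⊗ ε) ⊗ (ε ⊗ ε))) ⊜ u) refl u

  prefix-𝒜 : ∀ n a → a ≤ n → transfer fam𝒜 1# (suc n) 0 (just (0 , red)) a ≈ (one ⊕ S s t u 1#) a
  prefix-𝒜 n zero    _   = sym (+-identityʳ 1#)
  prefix-𝒜 n (suc a) a<n = begin
    transfer fam𝒜 1# (suc n) 0 (just (0 , red)) (suc a)
      ≈⟨ transfer-𝒜-restart 1# (suc n) (suc a) ⟩
    transfer fam𝒜 1# (suc n) 0 nothing (suc a)
      ≈⟨ transfer-bound-irrelevant fam𝒜 1# (suc n) (suc a) (suc a) 0 nothing (m≤n⇒m≤1+n a<n) ≤-refl ⟩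
    transfer fam𝒜 1# (suc a) 0 nothing (suc a)
      ≈⟨ gfOf-transfer fam𝒜 1# a ⟨
    S s t u 1# (suc a)
      ≈⟨ +-identityˡ _ ⟨
    (one ⊕ S s t u 1#) (suc a)
      ∎

  prefix-ℬ : ∀ n a → a ≤ n →
    t * transfer famℬ 1# (suc n) 0 (just (0 , black)) a ≈ (t · one ⊕ t · R s t u 1# ⊕ B s t u 1#) a
  prefix-ℬ n zero    _   = sym (trans (+-identityʳ _) (trans (+-congˡ (zeroʳ t)) (+-identityʳ _)))
  prefix-ℬ n (suc a) a<n = begin
    t * transfer famℬ 1# (suc n) 0 (just (0 , black)) (suc a)
      ≈⟨ *-congˡ (transfer-first famℬ 1# (suc n) a (just (0 , black)) (s≤s z≤n)) ⟩
    t * (factor famℬ 1# 0 (just (0 , black)) (0 , black) * afterBlack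
         + factor famℬ 1# 0 (just (0 , black)) (0 , red) * afterRed)
      ≈⟨ *-congˡ (+-cong (trans (*-congʳ sameSegment) (*-identityˡ _)) (*-congʳ redStep)) ⟩
    t * (afterBlack + u * afterRed)
      ≈⟨ *-congˡ (+-cong (transfer-bound-irrelevant famℬ 1# _ _ a 1 _ (m≤n⇒m≤1+n a<n) ≤-refl)
                         (*-congˡ (trans (transfer-ℬ≈ℛ 1# (suc n) a 1 (0 , red))
                                         (transfer-bound-irrelevant famℛ 1# _ _ a 1 _ (m≤n⇒m≤1+n a<n) ≤-refl)))) ⟩
    t * (blackPath + u * redPath)
      ≈⟨ distribˡ t _ _ ⟩
    t * blackPath + t * (u * redPath)
      ≈⟨ +-cong (B-at-1 a) (*-congˡ (R-at-1 a)) ⟨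
    B s t u 1# (suc a) + t * R s t u 1# (suc a)
      ≈⟨ +-comm _ _ ⟩
    t * R s t u 1# (suc a) + B s t u 1# (suc a)
      ≈⟨ +-congʳ (trans (sym (+-identityˡ _)) (+-congʳ (sym (zeroʳ t)))) ⟩
    (t · one ⊕ t · R s t u 1# ⊕ B s t u 1#) (suc a)
      ∎
    where
    afterBlack afterRed blackPath redPath : Carrier
    afterBlack = transfer famℬ 1# (suc n) 1 (just (0 , black)) a
    afterRed   = transfer famℬ 1# (suc n) 1 (just (0 , red)) a
    blackPath  = transfer famℬ 1# (suc a) 1 (just (0 , black)) a
    redPath    = transfer famℛ 1# (suc a) 1 (just (0 , red)) a
    sameSegment : 1# * (1# * (1# * (1# * 1#))) ≈ 1#
    sameSegment = solve 0 (ε ⊗ (ε ⊗ (ε ⊗ (ε ⊗ ε))) ⊜ ε) refl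

  prefix-ℛ : ∀ n a → a ≤ n →
    transfer famℛ 1# (suc n) 0 (just (0 , red)) a ≈ (one ⊕ R s t u 1# ⊕ B s t u 1#) a
  prefix-ℛ n zero    _   = sym (trans (+-identityʳ _) (+-identityʳ _))
  prefix-ℛ n (suc a) a<n = begin
    transfer famℛ 1# (suc n) 0 (just (0 , red)) (suc a)
      ≈⟨ transfer-first famℛ 1# (suc n) a (just (0 , red)) (s≤s z≤n) ⟩
    factor famℛ 1# 0 (just (0 , red)) (0 , black) * afterBlack
      + factor famℛ 1# 0 (just (0 , red)) (0 , red) * afterRed
      ≈⟨ +-cong (*-congʳ newSegment) (*-congʳ redStep) ⟩
    t * afterBlack + u * afterRed
      ≈⟨ +-cong (*-congˡ (trans (sym (transfer-ℬ≈ℛ 1# (suc n) a 1 (0 , black)))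
                                (transfer-bound-irrelevant famℬ 1# _ _ a 1 _ (m≤n⇒m≤1+n a<n) ≤-refl)))
                (*-congˡ (transfer-bound-irrelevant famℛ 1# _ _ a 1 _ (m≤n⇒m≤1+n a<n) ≤-refl)) ⟩
    t * transfer famℬ 1# (suc a) 1 (just (0 , black)) a + u * transfer famℛ 1# (suc a) 1 (just (0 , red)) a
      ≈⟨ +-cong (B-at-1 a) (R-at-1 a) ⟨
    B s t u 1# (suc a) + R s t u 1# (suc a)
      ≈⟨ trans (+-comm _ _) (+-congʳ (sym (+-identityˡ _))) ⟩
    (one ⊕ R s t u 1# ⊕ B s t u 1#) (suc a)
      ∎
    where
    afterBlack afterRed : Carrier
    afterBlack = transfer famℛ 1# (suc n) 1 (just (0 , black)) a
    afterRed   = transfer famℛ 1# (suc n) 1 (just (0 , red)) a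
    newSegment : 1# * ((t * 1#) * (1# * (1# * 1#))) ≈ t
    newSegment = solve 1 (λ t → ε ⊗ ((t ⊗ ε) ⊗ (ε ⊗ (ε ⊗ ε))) ⊜ t) refl t

  gfOf-equation : ∀ k v w r (P : Series) → firstWeight k v ≈ w * r →
    (∀ n a → a ≤ n → r * transfer k 1# (suc n) 0 (just (0 , firstColour k)) a ≈ P a) →
    gfOf k v ≋ w · zS (P ⊛ (one ⊕ s · B s t u v))
  gfOf-equation k v w r P _       _       zero    = sym (zeroʳ w)
  gfOf-equation k v w r P first≈ prefix≈ (suc n) = begin
    gfOf k v (suc n)
      ≈⟨ gfOf-firstReturn k v n ⟩
    firstWeight k v * sumBelow (λ a → prefix a * tail (n ∸ a)) (suc n)
      ≈⟨ trans (*-congʳ first≈) (*-assoc w r _) ⟩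
    w * (r * sumBelow (λ a → prefix a * tail (n ∸ a)) (suc n))
      ≈⟨ *-congˡ (*-distribˡ-sumBelow r (λ a → prefix a * tail (n ∸ a)) (suc n)) ⟩
    w * sumBelow (λ a → r * (prefix a * tail (n ∸ a))) (suc n)
      ≈⟨ *-congˡ (sumBelow-cong (suc n) (λ a a<n →
           trans (sym (*-assoc r (prefix a) (tail (n ∸ a)))) (*-congʳ (prefix≈ n a (≤-pred a<n))))) ⟩
    w * sumBelow (λ a → P a * tail (n ∸ a)) (suc n)
      ≈⟨ *-congˡ (Σ-map-upTo _ (suc n)) ⟨
    (w · zS (P ⊛ tail)) (suc n)
      ∎
    where
    tail : Series
    tail = one ⊕ s · B s t u v
    prefix : ℕ → Carrier
    prefix = transfer k 1# (suc n) 0 (just (0 , firstColour k))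

lemma4p3 : ∀ {c ℓ} (K : CommutativeSemiring c ℓ) → let open GF K in
    ∀ (s t u v : Carrier) →
      (S s t u v ≋ (u * v) · zS ((one ⊕ S s t u 1#) ⊛ (one ⊕ s · B s t u v)))
      × (B s t u v ≋ v · zS ((t · one ⊕ t · R s t u 1# ⊕ B s t u 1#) ⊛ (one ⊕ s · B s t u v)))
      × (R s t u v ≋ (u * v) · zS ((one ⊕ R s t u 1# ⊕ B s t u 1#) ⊛ (one ⊕ s · B s t u v)))
lemma4p3 K s t u v =
    gfOf-equation fam𝒜 v (u * v) 1# _ (sym (*-identityʳ _)) (λ n a a≤n → unit (prefix-𝒜 n a a≤n))
  , gfOf-equation famℬ v v t _ (*-comm t v) prefix-ℬ
  , gfOf-equation famℛ v (u * v) 1# _ (sym (*-identityʳ _)) (λ n a a≤n → unit (prefix-ℛ n a a≤n))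
  where
  open GF K
  open Transfer K s t u
  unit : ∀ {x y} → x ≈ y → 1# * x ≈ y
  unit = trans (*-identityˡ _)
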